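{- Let $\mathsf{Prop}$ be the collection of all propositions, with equality $P=Q$ iff $P\iff Q$ and binary relation $P<Q$ iff $\neg P\wedge Q$. Then $(\mathsf{Prop},<)$ is a generalized ordered set.
   Context: The setting is constructive mathematics: no use of the law of excluded middle. For a set $X$ with a binary relation $<$, write $x\leq_{P}y$ if for all $z\in X$, $z<x$ implies $z<y$, and $y<z$ implies $x<z$. A generalized ordered set is a set $X$ with a binary relation $<$ such that for all $x,y,z\in X$: (asymmetry) $x<y$ implies $\neg(y<x)$; (transitivity) $x<y$ and $y<z$ imply $x<z$; (positive antisymmetry) $x\leq_{P}y$ and $y\leq_{P}x$ imply $x=y$. -}

module Defs where

open import Level using (Level; suc; _⊔_)
open import Data.Product using (_×_)
open import Relation.Nullary using (¬_)
open import Function.Bundles using (_⇔_)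

-- A set X is modelled as a type with an equality relation _≈_
-- (an equivalence relation, setoid-style), and a binary relation _<_ on it.

module _ {a ℓ r : Level} {X : Set a} (_≈_ : X → X → Set ℓ) (_<_ : X → X → Set r) where

  _≤P_ : X → X → Set (a ⊔ r)
  x ≤P y = ∀ z → (z < x → z < y) × (y < z → x < z)

  record IsGeneralizedOrderedSet : Set (a ⊔ ℓ ⊔ r) where
    field
      ≈-refl  : ∀ {x} → x ≈ x
      ≈-sym   : ∀ {x y} → x ≈ y → y ≈ x
      ≈-trans : ∀ {x y z} → x ≈ y → y ≈ z → x ≈ z
      <-resp  : ∀ {x x′ y y′} → x ≈ x′ → y ≈ y′ → x < y → x′ < y′
      asym    : ∀ {x y} → x < y → ¬ (y < x)
      trans   : ∀ {x y z} → x < y → y < z → x < z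
      pos-antisym : ∀ {x y} → x ≤P y → y ≤P x → x ≈ y

PropEq : Set → Set → Set
PropEq P Q = P ⇔ Q

PropLt : Set → Set → Set
PropLt P Q = ¬ P × Q

-- Only positive antisymmetry needs an idea: test P ≤P Q at the false proposition.
-- Since ⊥ < P holds exactly when P does, P ≤P Q yields P → Q.
module Submission where

open import Defs
open import Data.Empty using (⊥)
open import Data.Product using (_,_; proj₁; proj₂)
open import Function.Base using (_∘_)
open import Function.Bundles using (_⇔_; mk⇔; Equivalence)
open import Function.Properties.Equivalence using (⇔-isEquivalence)
open import Level using (0ℓ)
open import Relation.Binary.Structures using (IsEquivalence)

private
  module ⇔ = IsEquivalence (⇔-isEquivalence {ℓ = 0ℓ})

⊥<⇔ : ∀ {P} → PropLt ⊥ P ⇔ P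
⊥<⇔ = mk⇔ proj₂ (λ p → (λ ()) , p)

≤P⇒→ : ∀ {P Q} → _≤P_ PropEq PropLt P Q → P → Q
≤P⇒→ P≤Q = Equivalence.to ⊥<⇔ ∘ proj₁ (P≤Q ⊥) ∘ Equivalence.from ⊥<⇔

theorem9 : IsGeneralizedOrderedSet PropEq PropLt
theorem9 = record
  { ≈-refl      = ⇔.refl
  ; ≈-sym       = ⇔.sym
  ; ≈-trans     = ⇔.trans
  ; <-resp      = λ x⇔x′ y⇔y′ (¬x , y) →
                    (λ x′ → ¬x (Equivalence.from x⇔x′ x′)) , Equivalence.to y⇔y′ y
  ; asym        = λ (¬x , _) (_ , x) → ¬x x
  ; trans       = λ (¬x , _) (_ , z) → ¬x , z
  ; pos-antisym = λ x≤y y≤x → mk⇔ (≤P⇒→ x≤y) (≤P⇒→ y≤x)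
  }
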